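{- Let $B$ be a decidable predicate on natural numbers such that $\neg\,\forall n.\,\neg B\,n$. Then $\{\mathsf{true}\}\ x:=0;\ \mathsf{while}\ \neg B\,x\ \mathsf{do}\ x:=x+1\ \{(\mathsf{true}\ast\ast\langle B\,x\rangle)\wedge\neg\,\mathit{infinite}\}$ is derivable in the trace-based Hoare logic.
   Context: Here $B\,x$ denotes the boolean expression (and state predicate) that holds in a state $\sigma$ exactly when $B$ holds of the value $\sigma\,x$ of the variable $x$. While statements: $s ::= x:=e \mid \mathsf{skip}\mid s_0;s_1\mid \mathsf{if}\ e\ \mathsf{then}\ s_t\ \mathsf{else}\ s_f\mid \mathsf{while}\ e\ \mathsf{do}\ s_t$; a state $\sigma$ assigns integers to variables, $[\![e]\!]\sigma$ is the value of $e$, $\sigma\models e$ means $e$ is true in $\sigma$. The metatheory is constructive. Traces are coinductive: $\langle\sigma\rangle$, and $\sigma::\tau$ for a trace $\tau$; bisimilarity $\approx$ is coinductive; $\mathit{hd}\langle\sigma\rangle=\mathit{hd}(\sigma::\tau)=\sigma$; infiniteness is coinductive ($\sigma::\tau$ is infinite if $\tau$ is), and $\mathit{infinite}$ is the trace predicate "is infinite". State predicates are arbitrary; trace predicates are setoid predicates (invariant under $\approx$); $\mathsf{true},\wedge,\neg,\exists$ are pointwise; $\models$ is entailment. $\langle U\rangle$ holds exactly of $\langle\sigma\rangle$ with $\sigma\models U$; $\mathrm{dup}(U)$ exactly of $\sigma::\langle\sigma\rangle$ with $\sigma\models U$; $U[x\mapsto e]$ exactly of $\sigma::\langle\sigma[x\mapsto[\![e]\!]\sigma]\rangle$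 with $\sigma\models U$. $\mathrm{follows}_Q(\tau,\tau')$ is coinductive: $\mathrm{follows}_Q(\langle\sigma\rangle,\tau)$ if $\mathit{hd}\,\tau=\sigma$ and $\tau\models Q$; $\mathrm{follows}_Q(\sigma::\tau,\sigma::\tau')$ if $\mathrm{follows}_Q(\tau,\tau')$. $\tau'\models P\ast\ast Q$ iff $\exists\tau$, $\tau\models P$ and $\mathrm{follows}_Q(\tau,\tau')$ (chains associate to the right). $P^{\dagger}$ is coinductive: $\tau\models P^{\dagger}$ if $\tau\models\langle\mathsf{true}\rangle$; $\tau'\models P^{\dagger}$ if $\exists\tau$, $\tau\models P$ and $\mathrm{follows}_{P^{\dagger}}(\tau,\tau')$. The trace-based Hoare logic derives $\{U\}\,s\,\{P\}$ inductively by: $\{U\}\,x:=e\,\{U[x\mapsto e]\}$; $\{U\}\,\mathsf{skip}\,\{\langle U\rangle\}$; from $\{U\}\,s_0\,\{P\ast\ast\langle V\rangle\}$ and $\{V\}\,s_1\,\{Q\}$ infer $\{U\}\,s_0;s_1\,\{P\ast\ast Q\}$; from $\{e\wedge U\}\,s_t\,\{P\}$ and $\{\neg e\wedge U\}\,s_f\,\{P\}$ infer $\{U\}\,\mathsf{if}\ e\ \mathsf{then}\ s_t\ \mathsf{else}\ s_f\,\{\mathrm{dup}(U)\ast\ast P\}$; from $U\models I$ and $\{e\wedge I\}\,s_t\,\{P\ast\ast\langle I\rangle\}$ infer $\{U\}\,\mathsf{while}\ e\ \mathsf{do}\ s_t\,\{\mathrm{dup}(U)\ast\ast(P\ast\ast\mathrm{dup}(I))^{\dagger}\ast\ast\langle\neg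 e\rangle\}$; from $U\models U'$, $\{U'\}\,s\,\{P'\}$, $P'\models P$ infer $\{U\}\,s\,\{P\}$; from $\forall z.\ \{U_z\}\,s\,\{P_z\}$ infer $\{\exists z.U_z\}\,s\,\{\exists z.P_z\}$. -}

module Defs where

open import Level using (Level; 0ℓ; _⊔_; Setω) renaming (suc to lsuc)
open import Data.Nat using (ℕ; _≡ᵇ_)
open import Data.Integer using (ℤ; +_; -[1+_])
open import Data.Bool using (Bool; true; false; not; if_then_else_; T)
open import Data.Unit using (⊤; tt)
open import Data.Empty using (⊥)
open import Data.Maybe using (Maybe; just; nothing)
open import Data.Product using (Σ; _×_; _,_; proj₁; proj₂)
open import Data.Sum using (_⊎_; inj₁; inj₂)
open import Relation.Nullary using (¬_; does)
open import Relation.Unary using (Decidable)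
open import Relation.Binary.PropositionalEquality using (_≡_; refl; sym; trans; subst)

Var : Set
Var = ℕ

State : Set
State = Var → ℤ

AExpr : Set
AExpr = State → ℤ

BExpr : Set
BExpr = State → Bool

_⊨ᵉ_ : State → BExpr → Set
σ ⊨ᵉ e = T (e σ)

notᵉ : BExpr → BExpr
notᵉ e σ = not (e σ)

_[_↦_] : State → Var → ℤ → State
(σ [ x ↦ v ]) y = if y ≡ᵇ x then v else σ y

predᵉ : {B : ℕ → Set} → Decidable B → Var → BExpr
predᵉ B? x σ with σ x
... | + n = does (B? n)
... | -[1+ n ] = false

data Stmt : Set where
  _≔_ : Var → AExpr → Stmt
  skip : Stmt
  _⨾_ : Stmt → Stmt → Stmt
  ifˢ_thenˢ_elseˢ_ : BExpr → Stmt → Stmt → Stmt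
  whileˢ_doˢ_ : BExpr → Stmt → Stmt

infixr 4 _⨾_

-- Coinductive traces (pointed coalgebras of  X ↦ State ⊎ State × X)

Out : Set → Set
Out X = State ⊎ (State × X)

record Trace : Set₁ where
  constructor mkTrace
  field
    Pos  : Set
    root : Pos
    out  : Pos → Out Pos

open Trace public

at : (τ : Trace) → Pos τ → Trace
at τ y = mkTrace (Pos τ) y (out τ)

hdO : ∀ {X} → Out X → State
hdO (inj₁ σ) = σ
hdO (inj₂ (σ , _)) = σ

hd : Trace → State
hd τ = hdO (out τ (root τ))

⟨_⟩ : State → Trace
⟨ σ ⟩ = mkTrace ⊤ tt (λ _ → inj₁ σ)

consOut : ∀ {X} → Out X → Out (Maybe X)
consOut (inj₁ σ) = inj₁ σ
consOut (inj₂ (σ , y)) = inj₂ (σ , just y)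

_∷_ : State → Trace → Trace
σ ∷ τ = mkTrace (Maybe (Pos τ)) nothing o
  where
  o : Maybe (Pos τ) → Out (Maybe (Pos τ))
  o nothing = inj₂ (σ , just (root τ))
  o (just y) = consOut (out τ y)

BStep : ∀ {X Y : Set} → (X → Y → Set) → Out X → Out Y → Set
BStep R (inj₁ σ) (inj₁ σ') = σ ≡ σ'
BStep R (inj₁ σ) (inj₂ _) = ⊥
BStep R (inj₂ _) (inj₁ σ') = ⊥
BStep R (inj₂ (σ , x)) (inj₂ (σ' , y)) = σ ≡ σ' × R x y

IsBisim : (τ τ' : Trace) → (Pos τ → Pos τ' → Set) → Set
IsBisim τ τ' R = ∀ {y y'} → R y y' → BStep R (out τ y) (out τ' y')

_≈_ : Trace → Trace → Set₁
τ ≈ τ' = Σ (Pos τ → Pos τ' → Set) λ R → R (root τ) (root τ') × IsBisim τ τ' R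

at-≈ : ∀ {τ τ' R} → IsBisim τ τ' R → ∀ {y y'} → R y y' → at τ y ≈ at τ' y'
at-≈ {R = R} b r = R , r , b

BStep-hd : ∀ {X Y} {R : X → Y → Set} (o : Out X) (o' : Out Y) → BStep R o o' → hdO o ≡ hdO o'
BStep-hd (inj₁ σ) (inj₁ σ') e = e
BStep-hd (inj₂ (σ , x)) (inj₂ (σ' , y)) (e , _) = e

BStep-sym : ∀ {X Y} {R : X → Y → Set} (o : Out X) (o' : Out Y) →
            BStep R o o' → BStep (λ y x → R x y) o' o
BStep-sym (inj₁ σ) (inj₁ σ') e = sym e
BStep-sym (inj₂ (σ , x)) (inj₂ (σ' , y)) (e , r) = sym e , r

BStep-trans : ∀ {X Y Z} {R : X → Y → Set} {S : Y → Z → Set}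
              (o : Out X) (o' : Out Y) (o'' : Out Z) →
              BStep R o o' → BStep S o' o'' →
              BStep (λ x z → Σ Y λ y → R x y × S y z) o o''
BStep-trans (inj₁ σ) (inj₁ σ') (inj₁ σ'') e e' = trans e e'
BStep-trans (inj₂ (σ , x)) (inj₂ (σ' , y)) (inj₂ (σ'' , z)) (e , r) (e' , s) =
  trans e e' , (y , r , s)

≈-refl : ∀ {τ} → τ ≈ τ
≈-refl {τ} = (λ y y' → y ≡ y') , refl , λ {y} {y'} e → subst (λ z → BStep _≡_ (out τ y) (out τ z)) e (refl-step (out τ y))
  where
  refl-step : (o : Out (Pos τ)) → BStep _≡_ o o
  refl-step (inj₁ σ) = refl
  refl-step (inj₂ (σ , x)) = refl , refl

≈-sym : ∀ {τ τ'} → τ ≈ τ' → τ' ≈ τ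
≈-sym {τ} {τ'} (R , r , b) =
  (λ y' y → R y y') , r , λ {y'} {y} p → BStep-sym (out τ y) (out τ' y') (b p)

≈-trans : ∀ {τ τ' τ''} → τ ≈ τ' → τ' ≈ τ'' → τ ≈ τ''
≈-trans {τ} {τ'} {τ''} (R , r , b) (S , s , c) =
  (λ x z → Σ (Pos τ') λ y → R x y × S y z) , (root τ' , r , s) ,
  λ { {x} {z} (y , p , q) → BStep-trans (out τ x) (out τ' y) (out τ'' z) (b p) (c q) }

IStep : ∀ {X : Set} → (X → Set) → Out X → Set
IStep R (inj₁ _) = ⊥
IStep R (inj₂ (_ , x)) = R x

Infinite : Trace → Set₁
Infinite τ = Σ (Pos τ → Set) λ R → R (root τ) × (∀ {y} → R y → IStep R (out τ y))

Infinite-inv : ∀ {τ τ'} → Infinite τ → τ ≈ τ' → Infinite τ'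
Infinite-inv {τ} {τ'} (R , r , c) (S , s , b) =
  (λ y' → Σ (Pos τ) λ y → R y × S y y') , (root τ , r , s) ,
  λ { {y'} (y , p , q) → step (out τ y) (out τ' y') (c p) (b q) }
  where
  step : (o : Out (Pos τ)) (o' : Out (Pos τ')) → IStep R o → BStep S o o' →
         IStep (λ y' → Σ (Pos τ) λ y → R y × S y y') o'
  step (inj₂ (σ , x)) (inj₂ (σ' , x')) p (e , q) = x , p , q

SPred : Set₁
SPred = State → Set

_⇒ˢ_ : SPred → SPred → Set
U ⇒ˢ V = ∀ σ → U σ → V σ

trueˢ : SPred
trueˢ _ = ⊤

_∧ˢ_ : BExpr → SPred → SPred
(e ∧ˢ U) σ = σ ⊨ᵉ e × U σ

⌜_⌝ : BExpr → SPred
⌜ e ⌝ σ = σ ⊨ᵉ e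

∃ˢ : {Z : Set} → (Z → SPred) → SPred
∃ˢ {Z} U σ = Σ Z λ z → U z σ

record TPred (ℓ : Level) : Set (lsuc (lsuc 0ℓ ⊔ ℓ)) where
  field
    pred : Trace → Set ℓ
    inv  : ∀ {τ τ'} → pred τ → τ ≈ τ' → pred τ'

open TPred public

_⇒ᵗ_ : ∀ {a b} → TPred a → TPred b → Set (lsuc 0ℓ ⊔ a ⊔ b)
P ⇒ᵗ Q = ∀ τ → pred P τ → pred Q τ

trueᵗ : TPred 0ℓ
pred trueᵗ _ = ⊤
inv trueᵗ _ _ = tt

_∧ᵗ_ : ∀ {a b} → TPred a → TPred b → TPred (a ⊔ b)
pred (P ∧ᵗ Q) τ = pred P τ × pred Q τ
inv (P ∧ᵗ Q) (p , q) e = inv P p e , inv Q q e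

¬ᵗ_ : ∀ {a} → TPred a → TPred a
pred (¬ᵗ P) τ = ¬ pred P τ
inv (¬ᵗ P) np e p = np (inv P p (≈-sym e))

∃ᵗ : ∀ {a} {Z : Set} → (Z → TPred a) → TPred a
pred (∃ᵗ {Z = Z} P) τ = Σ Z λ z → pred (P z) τ
inv (∃ᵗ P) (z , p) e = z , inv (P z) p e

infinite : TPred (lsuc 0ℓ)
pred infinite = Infinite
inv infinite = Infinite-inv

⟪_⟫ : SPred → TPred (lsuc 0ℓ)
pred ⟪ U ⟫ τ = Σ State λ σ → U σ × τ ≈ ⟨ σ ⟩
inv ⟪ U ⟫ (σ , u , p) e = σ , u , ≈-trans (≈-sym e) p

dup : SPred → TPred (lsuc 0ℓ)
pred (dup U) τ = Σ State λ σ → U σ × τ ≈ (σ ∷ ⟨ σ ⟩)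
inv (dup U) (σ , u , p) e = σ , u , ≈-trans (≈-sym e) p

_[_≔_]ᵗ : SPred → Var → AExpr → TPred (lsuc 0ℓ)
pred (U [ x ≔ e ]ᵗ) τ = Σ State λ σ → U σ × τ ≈ (σ ∷ ⟨ σ [ x ↦ e σ ] ⟩)
inv (U [ x ≔ e ]ᵗ) (σ , u , p) e' = σ , u , ≈-trans (≈-sym e') p

-- follows (coinductive), with the final condition C on positions of τ':
--   follows(⟨σ⟩, τ')        if hd τ' = σ and C holds of τ'
--   follows(σ :: τ, σ :: τ') if follows(τ, τ')

FStep : ∀ {c} (τ' : Trace) {X : Set} → (X → Pos τ' → Set c) → (Pos τ' → Set c) →
        Out X → Pos τ' → Set c
FStep τ' R C (inj₁ σ) y' = hd (at τ' y') ≡ σ × C y'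
FStep τ' R C (inj₂ (σ , z)) y' = Σ (Pos τ') λ z' → out τ' y' ≡ inj₂ (σ , z') × R z z'

FollowsPos : ∀ {c} (τ τ' : Trace) → (Pos τ' → Set c) → Set (lsuc c)
FollowsPos {c} τ τ' C =
  Σ (Pos τ → Pos τ' → Set c) λ R →
    R (root τ) (root τ') × (∀ {y y'} → R y y' → FStep τ' R C (out τ y) y')

Follows : ∀ {c} → TPred c → Trace → Trace → Set (lsuc c)
Follows Q τ τ' = FollowsPos τ τ' (λ y' → pred Q (at τ' y'))

FollowsPos-transport :
  ∀ {c} {τ τ₁ τ₂ : Trace} {C₁ : Pos τ₁ → Set c} {C₂ : Pos τ₂ → Set c}
  (S : Pos τ₁ → Pos τ₂ → Set) → IsBisim τ₁ τ₂ S → S (root τ₁) (root τ₂) →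
  (∀ {y₁ y₂} → S y₁ y₂ → C₁ y₁ → C₂ y₂) →
  FollowsPos τ τ₁ C₁ → FollowsPos τ τ₂ C₂
FollowsPos-transport {c} {τ} {τ₁} {τ₂} {C₁} {C₂} S b s₀ f (R , r₀ , cl) =
  R' , (root τ₁ , r₀ , s₀) , λ { {y} {y₂} (y₁ , r , s) → step (out τ y) y₁ y₂ (cl r) (b s) s }
  where
  R' : Pos τ → Pos τ₂ → Set c
  R' y y₂ = Σ (Pos τ₁) λ y₁ → R y y₁ × S y₁ y₂

  inj₂-step : ∀ {σ z₁} (o₂ : Out (Pos τ₂)) → BStep S (inj₂ (σ , z₁)) o₂ →
              Σ (Pos τ₂) λ z₂ → o₂ ≡ inj₂ (σ , z₂) × S z₁ z₂
  inj₂-step (inj₂ (σ' , z₂)) (refl , s) = z₂ , refl , s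

  step : (o : Out (Pos τ)) (y₁ : Pos τ₁) (y₂ : Pos τ₂) →
         FStep τ₁ R C₁ o y₁ → BStep S (out τ₁ y₁) (out τ₂ y₂) → S y₁ y₂ →
         FStep τ₂ R' C₂ o y₂
  step (inj₁ σ) y₁ y₂ (h , c₁) bs s =
    trans (sym (BStep-hd (out τ₁ y₁) (out τ₂ y₂) bs)) h , f s c₁
  step (inj₂ (σ , z)) y₁ y₂ (z₁ , eq , r) bs s
    with inj₂-step (out τ₂ y₂) (subst (λ o → BStep S o (out τ₂ y₂)) eq bs)
  ... | z₂ , eq₂ , s' = z₂ , eq₂ , (z₁ , r , s')

Follows-inv : ∀ {c} (Q : TPred c) {τ τ₁ τ₂} → Follows Q τ τ₁ → τ₁ ≈ τ₂ → Follows Q τ τ₂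
Follows-inv Q {τ} {τ₁} {τ₂} f (S , s₀ , b) =
  FollowsPos-transport S b s₀ (λ s q → inv Q q (at-≈ {τ₁} {τ₂} b s)) f

_**_ : ∀ {a c} → TPred a → TPred c → TPred (a ⊔ lsuc c)
pred (P ** Q) τ' = Σ Trace λ τ → pred P τ × Follows Q τ τ'
inv (P ** Q) (τ , p , f) e = τ , p , Follows-inv Q f e

infixr 5 _**_

-- P † (coinductive):
--   τ ⊨ P†  if τ ⊨ ⟨true⟩
--   τ' ⊨ P† if ∃τ, τ ⊨ P and follows_{P†}(τ, τ')
-- encoded by a post-fixed set D of positions of τ'.

DStep : ∀ {a} → TPred a → (τ' : Trace) → (Pos τ' → Set (lsuc 0ℓ ⊔ a)) → Pos τ' →
        Set (lsuc (lsuc 0ℓ ⊔ a))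
DStep P τ' D y' = pred ⟪ trueˢ ⟫ (at τ' y') ⊎ Σ Trace λ τ → pred P τ × FollowsPos τ (at τ' y') D

Dagger : ∀ {a} → TPred a → Trace → Set (lsuc (lsuc 0ℓ ⊔ a))
Dagger {a} P τ' =
  Σ (Pos τ' → Set (lsuc 0ℓ ⊔ a)) λ D → D (root τ') × (∀ {y'} → D y' → DStep P τ' D y')

Dagger-inv : ∀ {a} (P : TPred a) {τ₁ τ₂} → Dagger P τ₁ → τ₁ ≈ τ₂ → Dagger P τ₂
Dagger-inv {a} P {τ₁} {τ₂} (D , d₀ , cl) (S , s₀ , b) =
  D' , (root τ₁ , d₀ , s₀) , λ { (y₁ , d , s) → step y₁ _ s (cl d) }
  where
  D' : Pos τ₂ → Set (lsuc 0ℓ ⊔ a)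
  D' y₂ = Σ (Pos τ₁) λ y₁ → D y₁ × S y₁ y₂

  step : ∀ y₁ y₂ → S y₁ y₂ → DStep P τ₁ D y₁ → DStep P τ₂ D' y₂
  step y₁ y₂ s (inj₁ t) = inj₁ (inv ⟪ trueˢ ⟫ t (at-≈ {τ₁} {τ₂} b s))
  step y₁ y₂ s (inj₂ (τ , p , f)) =
    inj₂ (τ , p , FollowsPos-transport S b s (λ {z₁} {z₂} s' d → z₁ , d , s') f)

_† : ∀ {a} → TPred a → TPred (lsuc (lsuc 0ℓ ⊔ a))
pred (P †) = Dagger P
inv (P †) = Dagger-inv P

infix 6 _†

data ⊢⟦_⟧_⟦_⟧ : {ℓ : Level} → SPred → Stmt → TPred ℓ → Setω where
  h-assign : ∀ {U x e} → ⊢⟦ U ⟧ (x ≔ e) ⟦ U [ x ≔ e ]ᵗ ⟧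
  h-skip   : ∀ {U} → ⊢⟦ U ⟧ skip ⟦ ⟪ U ⟫ ⟧
  h-seq    : ∀ {a c} {U V s₀ s₁} {P : TPred a} {Q : TPred c} →
             ⊢⟦ U ⟧ s₀ ⟦ P ** ⟪ V ⟫ ⟧ → ⊢⟦ V ⟧ s₁ ⟦ Q ⟧ →
             ⊢⟦ U ⟧ (s₀ ⨾ s₁) ⟦ P ** Q ⟧
  h-if     : ∀ {a} {U e sₜ s_f} {P : TPred a} →
             ⊢⟦ e ∧ˢ U ⟧ sₜ ⟦ P ⟧ → ⊢⟦ notᵉ e ∧ˢ U ⟧ s_f ⟦ P ⟧ →
             ⊢⟦ U ⟧ (ifˢ e thenˢ sₜ elseˢ s_f) ⟦ dup U ** P ⟧
  h-while  : ∀ {a} {U I e sₜ} {P : TPred a} →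
             U ⇒ˢ I → ⊢⟦ e ∧ˢ I ⟧ sₜ ⟦ P ** ⟪ I ⟫ ⟧ →
             ⊢⟦ U ⟧ (whileˢ e doˢ sₜ) ⟦ dup U ** (P ** dup I) † ** ⟪ ⌜ notᵉ e ⌝ ⟫ ⟧
  h-conseq : ∀ {a b} {U U' s} {P' : TPred a} {P : TPred b} →
             U ⇒ˢ U' → ⊢⟦ U' ⟧ s ⟦ P' ⟧ → P' ⇒ᵗ P → ⊢⟦ U ⟧ s ⟦ P ⟧
  h-ex     : ∀ {a} {Z : Set} {U : Z → SPred} {s} {P : Z → TPred a} →
             (∀ z → ⊢⟦ U z ⟧ s ⟦ P z ⟧) → ⊢⟦ ∃ˢ U ⟧ s ⟦ ∃ᵗ P ⟧

module Submission where

-- The derivation is immediate from the rules (assignment, while with the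
-- invariant "x = k and B fails below k", consequence); the work is the
-- semantic entailment from the derived postcondition to the stated one.  From the latter come
-- two compositional properties:
--   * EndsIn W (every terminal state satisfies W) passes from Q to P ** Q,
--     and EndsIn W τ gives τ ⊨ true ** ⟨W⟩;
--   * Preserves Φ (a depth-indexed invariant) passes through P ** Q and,
--     when every P-trace takes at least one step, through P†.
-- In the module LinearSearch, a loop iteration is up to bisimilarity
-- σ ∷ σ⁺ ∷ ⟨σ⁺⟩ with x incremented, so "after n loop steps x = k, B fails
-- below k, and n ≤ 2k" is preserved by the loop.  An infinite run has paths
-- of every length; one of 2(N + 1) loop steps reaches x > N, so ¬ B N,
-- refuting any witness N.  The terminal states are those of the loop, where
-- the guard ¬ B x is false.

open import Defs
open import Data.Nat using (ℕ)
open import Data.Integer using (+_; _+_)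
open import Relation.Nullary using (¬_)
open import Relation.Unary using (Decidable)

open import Level using (0ℓ; Lift; lift) renaming (suc to lsuc)
open import Level.Literals using (#_)
open import Data.Nat using (zero; suc; _≤_; _<_; _*_; z≤n; s≤s) renaming (_+_ to _+ₙ_)
open import Data.Nat.Properties
  using (+-identityʳ; +-assoc; +-comm; *-suc; *-cancelˡ-≤; <⇒≤; m≤n+m; m<1+n⇒m<n∨m≡n; ≡⇒≡ᵇ)
open import Data.Nat.Induction using (<-wellFounded)
open import Induction.WellFounded using (Acc; acc)
open import Data.Bool using (not; T)
open import Data.Bool.Properties using (T-≡; not-involutive)
open import Data.Unit using (⊤; tt)
open import Data.Empty using (⊥; ⊥-elim)
open import Data.Maybe using (Maybe; just; nothing)
open import Data.Product using (Σ; _×_; _,_; proj₁; proj₂)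
open import Data.Sum using (_⊎_; inj₁; inj₂)
open import Data.Sum.Properties using (inj₁-injective)
open import Function.Bundles using (Equivalence)
open import Relation.Nullary using (does; yes; no)
open import Relation.Binary.PropositionalEquality using (_≡_; _≢_; refl; sym; trans; cong; subst; module ≡-Reasoning)

Path : {X : Set} → (X → Out X) → ℕ → X → X → Set
Path o zero y w = y ≡ w
Path {X} o (suc n) y w = Σ State λ σ → Σ X λ z → o y ≡ inj₂ (σ , z) × Path o n z w

step≢end : ∀ {X : Set} {σ σ' : State} {z : X} → inj₂ (σ , z) ≢ inj₁ σ'
step≢end ()

path-snoc : ∀ {X} {o : X → Out X} n {y w σ z} → Path o n y w → o w ≡ inj₂ (σ , z) → Path o (suc n) y z
path-snoc zero refl step = _ , _ , step , refl
path-snoc (suc n) (σ , z , e , p) step = σ , z , e , path-snoc n p step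

bstep-step : ∀ {X Y} {S : X → Y → Set} {σ z} (o : Out Y) → BStep S (inj₂ (σ , z)) o →
             Σ Y λ z' → o ≡ inj₂ (σ , z') × S z z'
bstep-step (inj₂ (σ , z')) (refl , s) = z' , refl , s

bstep-end : ∀ {X Y} {S : X → Y → Set} {σ} (o : Out X) → BStep S o (inj₁ σ) → o ≡ inj₁ σ
bstep-end (inj₁ σ) refl = refl

path-≈ : ∀ {τ τ' S} → IsBisim τ τ' S → ∀ n {y y' w} → S y y' → Path (out τ) n y w →
         Σ (Pos τ') λ w' → Path (out τ') n y' w' × S w w'
path-≈ b zero s refl = _ , refl , s
path-≈ {τ} {τ'} {S} b (suc n) {y} {y'} s (σ , z , e , p)
  with bstep-step (out τ' y') (subst (λ o → BStep S o (out τ' y')) e (b s))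
... | z' , e' , s' with path-≈ {τ} {τ'} {S} b n s' p
...   | w' , p' , sw = w' , (σ , z' , e' , p') , sw

hd-≈ : ∀ {τ τ'} → τ ≈ τ' → hd τ ≡ hd τ'
hd-≈ {τ} {τ'} (S , s₀ , b) = BStep-hd (out τ (root τ)) (out τ' (root τ')) (b s₀)

single-root : ∀ {τ σ} → τ ≈ ⟨ σ ⟩ → out τ (root τ) ≡ inj₁ σ
single-root {τ} (S , s₀ , b) = bstep-end (out τ (root τ)) (b s₀)

Moves : Trace → Set
Moves τ = Σ State λ σ → Σ (Pos τ) λ z → out τ (root τ) ≡ inj₂ (σ , z)

moves-≈ : ∀ {τ σ τ₂} → τ ≈ (σ ∷ τ₂) → Moves τ
moves-≈ {τ} (S , s₀ , b) with bstep-step (out τ (root τ)) (BStep-sym (out τ (root τ)) _ (b s₀))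
... | z , first , _ = _ , z , first

end-≈ : ∀ {τ y σ} → out τ y ≡ inj₁ σ → at τ y ≈ ⟨ σ ⟩
end-≈ {τ} {y} {σ} e = (λ a _ → a ≡ y) , refl , λ { refl → subst (λ o → BStep _ o (inj₁ σ)) (sym e) refl }

unfold-≈ : ∀ {τ σ z} → out τ (root τ) ≡ inj₂ (σ , z) → τ ≈ (σ ∷ at τ z)
unfold-≈ {τ} {σ} {z} e = S , refl , bisim
  where
  S : Pos τ → Maybe (Pos τ) → Set
  S y nothing = y ≡ root τ
  S y (just y') = y ≡ y'

  cons : (o : Out (Pos τ)) → BStep S o (consOut o)
  cons (inj₁ _) = refl
  cons (inj₂ _) = refl , refl

  bisim : IsBisim τ (σ ∷ at τ z) S
  bisim {_} {nothing} refl = subst (λ o → BStep S o (inj₂ (σ , just z))) (sym e) (refl , refl)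
  bisim {y} {just .y} refl = cons (out τ y)

∷-cong : ∀ {σ τ τ'} → τ ≈ τ' → (σ ∷ τ) ≈ (σ ∷ τ')
∷-cong {σ} {τ} {τ'} (R , r₀ , b) = S , tt , λ {y} {y'} → bisim {y} {y'}
  where
  S : Maybe (Pos τ) → Maybe (Pos τ') → Set
  S nothing nothing = ⊤
  S (just y) (just y') = R y y'
  S _ _ = ⊥

  cons : (o : Out (Pos τ)) (o' : Out (Pos τ')) → BStep R o o' → BStep S (consOut o) (consOut o')
  cons (inj₁ _) (inj₁ _) e = e
  cons (inj₂ _) (inj₂ _) e = e
  cons (inj₁ _) (inj₂ _) ()
  cons (inj₂ _) (inj₁ _) ()

  bisim : IsBisim (σ ∷ τ) (σ ∷ τ') S
  bisim {nothing} {nothing} _ = refl , r₀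
  bisim {just y} {just y'} r = cons (out τ y) (out τ' y') (b r)
  bisim {nothing} {just _} ()
  bisim {just _} {nothing} ()

infinite-path : ∀ {τ} → Infinite τ → ∀ n → Σ (Pos τ) λ w → Path (out τ) n (root τ) w
infinite-path {τ} (Ri , r₀ , c) n = from n r₀
  where
  from : ∀ n {y} → Ri y → Σ (Pos τ) λ w → Path (out τ) n y w
  from zero r = _ , refl
  from (suc n) {y} r = first-step (out τ y) refl (c r)
    where
    first-step : (o : Out (Pos τ)) → out τ y ≡ o → IStep Ri o → Σ (Pos τ) λ w → Path (out τ) (suc n) y w
    first-step (inj₂ (σ , z)) e rz = proj₁ (from n rz) , (σ , z , e , proj₂ (from n rz))

infinite-tail : ∀ {τ σ τ₂} → Infinite τ → τ ≈ (σ ∷ τ₂) → Infinite τ₂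
infinite-tail {τ₂ = τ₂} inf eq with Infinite-inv inf eq
... | Ri , r₀ , c = (λ y → Ri (just y)) , c r₀ , λ {y} r → tail (out τ₂ y) (c r)
  where
  tail : (o : Out (Pos τ₂)) → IStep Ri (consOut o) → IStep (λ y → Ri (just y)) o
  tail (inj₂ _) r = r

followsPos-hd : ∀ {c} {τ τ'} {C : Pos τ' → Set c} → FollowsPos τ τ' C → hd τ ≡ hd τ'
followsPos-hd {τ = τ} {τ'} {C} (R , r₀ , closed) = start (out τ (root τ)) (closed r₀)
  where
  start : (o : Out (Pos τ)) → FStep τ' R C o (root τ') → hdO o ≡ hd τ'
  start (inj₁ σ) (joins , _) = sym joins
  start (inj₂ _) (_ , e , _) = sym (cong hdO e)

record Lockstep (τ τ' : Trace) (n : ℕ) (y : Pos τ) (w : Pos τ') : Set where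
  field
    z     : Pos τ
    path  : Path (out τ) n y z
    σ     : State
    next  : Pos τ
    next' : Pos τ'
    step  : out τ z ≡ inj₂ (σ , next)
    step' : out τ' w ≡ inj₂ (σ , next')

record Handover {c} (τ τ' : Trace) (C : Pos τ' → Set c) (n : ℕ) (y : Pos τ) (w : Pos τ') : Set c where
  field
    j m       : ℕ
    split     : j +ₙ m ≡ n
    t         : Pos τ
    σ         : State
    w'        : Pos τ'
    path      : Path (out τ) j y t
    ends      : out τ t ≡ inj₁ σ
    joins     : hd (at τ' w') ≡ σ
    continues : C w'
    rest      : Path (out τ') m w' w

module _ {c} {τ τ' : Trace} {C : Pos τ' → Set c} {R : Pos τ → Pos τ' → Set c}
         (closed : ∀ {y y'} → R y y' → FStep τ' R C (out τ y) y') where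

  extend : ∀ {n y z w σ} → out τ y ≡ inj₂ (σ , z) →
           Lockstep τ τ' n z w ⊎ Handover τ τ' C n z w → Lockstep τ τ' (suc n) y w ⊎ Handover τ τ' C (suc n) y w
  extend {z = z} {σ = σ} e (inj₁ l) = inj₁ (record
    { z = z' ; path = σ , z , e , path ; σ = σ' ; next = next ; next' = next' ; step = step ; step' = step' })
    where open Lockstep l renaming (z to z'; σ to σ')
  extend {z = z} {σ = σ} e (inj₂ h) = inj₂ (record
    { j = suc j ; m = m ; split = cong suc split ; t = t ; σ = σ' ; w' = w' ; path = σ , z , e , path
    ; ends = ends ; joins = joins ; continues = continues ; rest = rest })
    where open Handover h renaming (σ to σ')

  follows-path : ∀ n {y y' w} → R y y' → Path (out τ') n y' w →
                 Lockstep τ τ' n y w ⊎ Handover τ τ' C n y w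
  follows-path n r p = along n _ refl (closed r) p
    where
    along : ∀ n {y y' w} (o : Out (Pos τ)) → out τ y ≡ o → FStep τ' R C o y' → Path (out τ') n y' w →
            Lockstep τ τ' n y w ⊎ Handover τ τ' C n y w
    along n {y} {y'} (inj₁ σ) e (joins , cont) p =
      inj₂ (record { j = 0 ; m = n ; split = refl ; t = y ; σ = σ ; w' = y' ; path = refl
                   ; ends = e ; joins = joins ; continues = cont ; rest = p })
    along zero {y} (inj₂ (σ , z)) e (z' , e' , _) refl =
      inj₁ (record { z = y ; path = refl ; σ = σ ; next = z ; next' = z' ; step = e ; step' = e' })
    along (suc n) (inj₂ (σ , z)) e (z' , e' , r') (σ₁ , z₁ , e₁ , p) with trans (sym e') e₁
    ... | refl = extend e (along n (out τ z) refl (closed r') p)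

follows-one-step : ∀ {c} {Q : TPred c} {τ τ' σ σ'} → τ ≈ (σ ∷ ⟨ σ' ⟩) → Follows Q τ τ' →
                   Σ Trace λ τ₂ → pred Q τ₂ × hd τ₂ ≡ σ' × τ' ≈ (σ ∷ τ₂)
follows-one-step {τ = τ} {τ'} (S , s₀ , b) (R , r₀ , closed)
  with bstep-step (out τ (root τ)) (BStep-sym (out τ (root τ)) _ (b s₀))
... | z , first , s with subst (λ o → FStep τ' R _ o (root τ')) first (closed r₀)
...   | z' , first' , r with subst (λ o → FStep τ' R _ o z') (bstep-end (out τ z) (b s)) (closed r)
...     | joins , q = at τ' z' , q , joins , unfold-≈ first'

EndsIn : SPred → Trace → Set
EndsIn W τ = ∀ n w σ → Path (out τ) n (root τ) w → out τ w ≡ inj₁ σ → W σ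

ends-⟪⟫ : ∀ {W τ} → pred ⟪ W ⟫ τ → EndsIn W τ
ends-⟪⟫ {W} (σ , u , single) zero _ σ' refl end = subst W (inj₁-injective (trans (sym (single-root single)) end)) u
ends-⟪⟫ (σ , _ , single) (suc n) _ _ (_ , _ , first , _) _ = ⊥-elim (step≢end (trans (sym first) (single-root single)))

ends-one-step : ∀ {W σ σ'} → W σ' → EndsIn W (σ ∷ ⟨ σ' ⟩)
ends-one-step u zero _ _ refl ()
ends-one-step u 1 _ _ (_ , _ , refl , refl) refl = u
ends-one-step u (suc (suc n)) _ _ (_ , _ , refl , _ , _ , () , _) _

ends-** : ∀ {a c} {P : TPred a} {Q : TPred c} {W} → (∀ {τ} → pred Q τ → EndsIn W τ) →
          ∀ {τ} → pred (P ** Q) τ → EndsIn W τ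
ends-** {Q = Q} hQ {τ'} (τ , _ , (R , r₀ , closed)) n w σ p end
  with follows-path {τ = τ} {τ'} {λ y → pred Q (at τ' y)} {R} closed n r₀ p
... | inj₁ l = ⊥-elim (step≢end (trans (sym (Lockstep.step' l)) end))
... | inj₂ h = hQ (Handover.continues h) (Handover.m h) w σ (Handover.rest h) end

follows-self : ∀ {W τ} → EndsIn W τ → Follows ⟪ W ⟫ τ τ
follows-self {W} {τ} ends = R , lift (refl , 0 , refl) , λ { (lift (refl , n , p)) → fstep n p _ refl }
  where
  R : Pos τ → Pos τ → Set (lsuc 0ℓ)
  R y y' = Lift (lsuc 0ℓ) (y ≡ y' × Σ ℕ λ n → Path (out τ) n (root τ) y)

  fstep : ∀ n {y} → Path (out τ) n (root τ) y → (o : Out (Pos τ)) → out τ y ≡ o →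
          FStep τ R (λ y' → pred ⟪ W ⟫ (at τ y')) o y
  fstep n {y} p (inj₁ σ) e = cong hdO e , σ , ends n y σ p e , end-≈ {τ} e
  fstep n p (inj₂ (σ , z)) e = z , e , lift (refl , suc n , path-snoc n p e)

assign-then : ∀ {U W : SPred} {y e} → (∀ σ → U σ → W (σ [ y ↦ e σ ])) →
              (U [ y ≔ e ]ᵗ) ⇒ᵗ ((U [ y ≔ e ]ᵗ) ** ⟪ W ⟫)
assign-then {W = W} {y} {e} establishes τ (σ , u , eq) =
  σ ∷ ⟨ σ [ y ↦ e σ ] ⟩ , (σ , u , ≈-refl) , Follows-inv ⟪ W ⟫ (follows-self (ends-one-step (establishes σ u))) (≈-sym eq)

Preserves : (ℕ → State → Set) → Trace → Set
Preserves Φ τ = ∀ k → Φ k (hd τ) → ∀ i w → Path (out τ) i (root τ) w → Φ (k +ₙ i) (hdO (out τ w))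

preserves-≈ : ∀ {Φ τ τ'} → τ ≈ τ' → Preserves Φ τ' → Preserves Φ τ
preserves-≈ {Φ} {τ} {τ'} eq@(S , s₀ , b) pres k φ i w p with path-≈ {τ} {τ'} {S} b i s₀ p
... | w' , p' , s = subst (Φ (k +ₙ i)) (sym (BStep-hd (out τ w) (out τ' w') (b s)))
                      (pres k (subst (Φ k) (hd-≈ eq) φ) i w' p')

preserves-⟪⟫ : ∀ {Φ W τ} → pred ⟪ W ⟫ τ → Preserves Φ τ
preserves-⟪⟫ {Φ} _ k φ zero _ refl = subst (λ i → Φ i _) (sym (+-identityʳ k)) φ
preserves-⟪⟫ (_ , _ , single) k φ (suc i) _ (_ , _ , first , _) = ⊥-elim (step≢end (trans (sym first) (single-root single)))

preserves-two-steps : ∀ {Φ σ₀ σ₁ σ₂} → (∀ k → Φ k σ₀ → Φ (suc k) σ₁ × Φ (suc (suc k)) σ₂) →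
                      Preserves Φ (σ₀ ∷ (σ₁ ∷ ⟨ σ₂ ⟩))
preserves-two-steps {Φ} h k φ zero _ refl = subst (λ i → Φ i _) (sym (+-identityʳ k)) φ
preserves-two-steps {Φ} {σ₁ = σ₁} h k φ 1 _ (_ , _ , refl , refl) = subst (λ i → Φ i σ₁) (+-comm 1 k) (proj₁ (h k φ))
preserves-two-steps {Φ} {σ₂ = σ₂} h k φ 2 _ (_ , _ , refl , _ , _ , refl , refl) = subst (λ i → Φ i σ₂) (+-comm 2 k) (proj₂ (h k φ))
preserves-two-steps h k φ (suc (suc (suc i))) _ (_ , _ , refl , _ , _ , refl , _ , _ , () , _)

offset : ∀ k {j m n} → j +ₙ m ≡ n → k +ₙ j +ₙ m ≡ k +ₙ n
offset k {j} {m} refl = +-assoc k j m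

follows-preserves : ∀ {c Φ τ τ'} {C : Pos τ' → Set c} → Preserves Φ τ → FollowsPos τ τ' C →
                    ∀ k → Φ k (hd τ') → ∀ n w → Path (out τ') n (root τ') w →
                    Φ (k +ₙ n) (hdO (out τ' w))
                    ⊎ Σ (Handover τ τ' C n (root τ) w) λ h → Φ (k +ₙ Handover.j h) (hd (at τ' (Handover.w' h)))
follows-preserves {Φ = Φ} {τ} {τ'} {C} pres F@(R , r₀ , closed) k φ n w p = conclude (follows-path {C = C} closed n r₀ p)
  where
  φ₀ : Φ k (hd τ)
  φ₀ = subst (Φ k) (sym (followsPos-hd F)) φ

  conclude : Lockstep τ τ' n (root τ) w ⊎ Handover τ τ' C n (root τ) w →
             Φ (k +ₙ n) (hdO (out τ' w))
             ⊎ Σ (Handover τ τ' C n (root τ) w) λ h → Φ (k +ₙ Handover.j h) (hd (at τ' (Handover.w' h)))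
  conclude (inj₁ l) = inj₁ (subst (Φ (k +ₙ n)) (trans (cong hdO step) (sym (cong hdO step'))) (pres k φ₀ n z path))
    where open Lockstep l
  conclude (inj₂ h) = inj₂ (h , subst (Φ (k +ₙ j)) (trans (cong hdO ends) (sym joins)) (pres k φ₀ j t path))
    where open Handover h

preserves-** : ∀ {a c Φ} {P : TPred a} {Q : TPred c} →
               (∀ {τ} → pred P τ → Preserves Φ τ) → (∀ {τ} → pred Q τ → Preserves Φ τ) →
               ∀ {τ} → pred (P ** Q) τ → Preserves Φ τ
preserves-** {Φ = Φ} {Q = Q} hP hQ {τ'} (τ , p , F) k φ n w path
  with follows-preserves {Φ = Φ} {C = λ y → pred Q (at τ' y)} (hP p) F k φ n w path
... | inj₁ ok = ok
... | inj₂ (h , φ') = subst (λ i → Φ i (hdO (out τ' w))) (offset k split) (hQ continues (k +ₙ j) φ' m w rest)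
  where open Handover h

-- If every P-trace takes a step and preserves Φ, so does every P†-trace.  The
-- induction is on path length: a hand-over happens after at least one step.
preserves-† : ∀ {a Φ} {P : TPred a} → (∀ {τ} → pred P τ → Moves τ × Preserves Φ τ) →
              ∀ {τ} → pred (P †) τ → Preserves Φ τ
preserves-† {Φ = Φ} {P} hP {τ'} (D , d₀ , cl) k φ n w p = from n (<-wellFounded n) d₀ k φ w p
  where
  late : ∀ {τ} → Moves τ → ∀ j {t σ} → Path (out τ) j (root τ) t → out τ t ≡ inj₁ σ →
         ∀ {m n} → j +ₙ m ≡ n → m < n
  late (_ , _ , first) zero refl ends _ = ⊥-elim (step≢end (trans (sym first) ends))
  late _ (suc j) _ _ refl = s≤s (m≤n+m _ j)

  from : ∀ n → Acc _<_ n → ∀ {y} → D y → ∀ k → Φ k (hd (at τ' y)) →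
         ∀ w → Path (out τ') n y w → Φ (k +ₙ n) (hdO (out τ' w))
  from n (acc rec) {y} d k φ w p with cl d
  ... | inj₁ single = preserves-⟪⟫ {Φ} single k φ n w p
  ... | inj₂ (τ , pτ , F) with hP pτ
  ...   | moves , pres with follows-preserves {Φ = Φ} {τ' = at τ' y} {C = D} pres F k φ n w p
  ...     | inj₁ ok = ok
  ...     | inj₂ (h , φ') =
    let open Handover h in
    subst (λ i → Φ i (hdO (out τ' w))) (offset k split)
      (from m (rec (late moves j path ends split)) continues (k +ₙ j) φ' w rest)

module LinearSearch (B : ℕ → Set) (B? : Decidable B) (x : Var) where

  guard : BExpr
  guard = notᵉ (predᵉ B? x)

  increment : AExpr
  increment σ = σ x + + 1

  next : State → State
  next σ = σ [ x ↦ increment σ ]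

  Scanned : ℕ → SPred
  Scanned k σ = σ x ≡ + k × (∀ j → j < k → ¬ B j)

  Inv : SPred
  Inv σ = Σ ℕ λ k → Scanned k σ

  Start : SPred
  Start σ = σ x ≡ + 0

  Init : TPred (# 1)
  Init = trueˢ [ x ≔ (λ σ → + 0) ]ᵗ

  Body : TPred (# 1)
  Body = (guard ∧ˢ Inv) [ x ≔ increment ]ᵗ

  Iteration : TPred (# 2)
  Iteration = Body ** dup Inv

  Loop : TPred (# 3)
  Loop = Iteration † ** ⟪ ⌜ notᵉ guard ⌝ ⟫

  Post : TPred (# 5)
  Post = Init ** (dup Start ** Loop)

  update-here : ∀ σ v → (σ [ x ↦ v ]) x ≡ v
  update-here σ v rewrite Equivalence.to T-≡ (≡⇒≡ᵇ x x refl) = refl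

  guard-at : ∀ {σ k} → σ x ≡ + k → predᵉ B? x σ ≡ does (B? k)
  guard-at {σ} e with σ x | e
  ... | .(+ _) | refl = refl

  scanned-next : ∀ {σ k} → T (guard σ) → Scanned k σ → Scanned (suc k) (next σ)
  scanned-next {σ} {k} g (xk , below) = x-next , below-next
    where
    open ≡-Reasoning

    not-Bk : ¬ B k
    not-Bk b with B? k | guard-at {σ} xk
    ... | yes _ | e = subst (λ v → T (not v)) e g
    ... | no ¬b | _ = ¬b b

    x-next : next σ x ≡ + suc k
    x-next = begin
      next σ x     ≡⟨ update-here σ (increment σ) ⟩
      σ x + + 1    ≡⟨ cong (_+ + 1) xk ⟩
      + (k +ₙ 1)   ≡⟨ cong +_ (+-comm k 1) ⟩
      + suc k      ∎

    below-next : ∀ j → j < suc k → ¬ B j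
    below-next j j<1+k with m<1+n⇒m<n∨m≡n j<1+k
    ... | inj₁ j<k = below j j<k
    ... | inj₂ refl = not-Bk

  -- The derivation: sequence of the assignment rule and the while rule with
  -- invariant Inv, each assignment strengthened to name its final state.
  derivation : ⊢⟦ trueˢ ⟧ (x ≔ (λ σ → + 0)) ⨾ (whileˢ guard doˢ (x ≔ increment)) ⟦ Post ⟧
  derivation =
    h-seq {V = Start} {P = Init} {Q = dup Start ** Loop}
      (h-conseq (λ _ t → t) h-assign (assign-then (λ σ _ → update-here σ (+ 0))))
      (h-while {U = Start} {I = Inv} {P = Body} (λ σ start → 0 , start , λ _ ())
        (h-conseq (λ _ u → u) h-assign (assign-then {W = Inv} (λ σ (g , k , s) → suc k , scanned-next {σ} g s))))

  Explored : ℕ → SPred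
  Explored n σ = Σ ℕ λ k → Scanned k σ × n ≤ 2 * k

  iteration-shape : ∀ {τ} → pred Iteration τ → Σ State λ σ → (guard ∧ˢ Inv) σ × τ ≈ (σ ∷ (next σ ∷ ⟨ next σ ⟩))
  iteration-shape (_ , (σ , u , body) , F) with follows-one-step {Q = dup Inv} body F
  ... | τ₂ , (s , _ , repeat) , joins , τ≈ =
    σ , u , ≈-trans τ≈ (∷-cong (subst (λ s → τ₂ ≈ (s ∷ ⟨ s ⟩)) (trans (sym (hd-≈ repeat)) joins) repeat))

  iteration-progress : ∀ {τ} → pred Iteration τ → Moves τ × Preserves Explored τ
  iteration-progress it with iteration-shape it
  ... | σ , (g , _) , τ≈ = moves-≈ τ≈ , preserves-≈ {Explored} τ≈ (preserves-two-steps {Explored} advance)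
    where
    advance : ∀ n → Explored n σ → Explored (suc n) (next σ) × Explored (suc (suc n)) (next σ)
    advance n (k , s , n≤2k) = (suc k , scanned-next {σ} g s , <⇒≤ two-more) , (suc k , scanned-next {σ} g s , two-more)
      where
      two-more : suc (suc n) ≤ 2 * suc k
      two-more = subst (suc (suc n) ≤_) (sym (*-suc 2 k)) (s≤s (s≤s n≤2k))

  loop-progress : ∀ {τ} → pred Loop τ → Preserves Explored τ
  loop-progress = preserves-** {Φ = Explored} {Iteration †} {⟪ ⌜ notᵉ guard ⌝ ⟫}
                    (preserves-† {Φ = Explored} {Iteration} iteration-progress) (preserves-⟪⟫ {Explored})

  -- A run of the loop from x = 0 cannot be infinite: it has paths of every
  -- length, and one of 2(N + 1) steps reaches x = k > N, so B fails at N.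
  loop-finite : ¬ (∀ n → ¬ B n) → ∀ {τ} → pred Loop τ → Start (hd τ) → ¬ Infinite τ
  loop-finite someB {τ} loop start inf =
    someB λ N → let (w , p) = infinite-path inf (2 * suc N) in
                refutes N (hdO (out τ w)) (loop-progress loop 0 (0 , (start , λ _ ()) , z≤n) (2 * suc N) w p)
    where
    refutes : ∀ N σ → Explored (2 * suc N) σ → ¬ B N
    refutes N _ (k , (_ , below) , 2N+2≤2k) = below N (*-cancelˡ-≤ 2 2N+2≤2k)

  -- The initialisation and the loop entry are one step each, so an infinite
  -- program run contains an infinite loop run from a state with x = 0.
  enter-loop : ∀ {τ} → pred Post τ → Infinite τ → Σ Trace λ τ₃ → pred Loop τ₃ × Start (hd τ₃) × Infinite τ₃
  enter-loop (_ , (_ , _ , assign) , F) inf =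
    let (τ₂ , (_ , (_ , start , entry) , G) , _ , τ≈) = follows-one-step {Q = dup Start ** Loop} assign F
        (τ₃ , loop , joins , τ₂≈) = follows-one-step {Q = Loop} entry G
    in τ₃ , loop , subst Start (sym joins) start , infinite-tail (infinite-tail inf τ≈) τ₂≈

  post-finite : ¬ (∀ n → ¬ B n) → ∀ {τ} → pred Post τ → ¬ Infinite τ
  post-finite someB post inf =
    let (_ , loop , start , inf₃) = enter-loop post inf in loop-finite someB loop start inf₃

  -- A program run ends where its loop run ends, i.e. with the guard false.
  post-ends : ∀ {τ} → pred Post τ → EndsIn ⌜ predᵉ B? x ⌝ τ
  post-ends post n w σ p end = subst T (not-involutive _) (run-ends post n w σ p end)
    where
    loop-ends : ∀ {τ} → pred Loop τ → EndsIn ⌜ notᵉ guard ⌝ τ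
    loop-ends = ends-** {P = Iteration †} {Q = ⟪ ⌜ notᵉ guard ⌝ ⟫} ends-⟪⟫

    run-ends : ∀ {τ} → pred Post τ → EndsIn ⌜ notᵉ guard ⌝ τ
    run-ends = ends-** {P = Init} {Q = dup Start ** Loop} (ends-** {P = dup Start} {Q = Loop} loop-ends)

  post-sound : ¬ (∀ n → ¬ B n) → Post ⇒ᵗ ((trueᵗ ** ⟪ ⌜ predᵉ B? x ⌝ ⟫) ∧ᵗ (¬ᵗ infinite))
  post-sound someB τ post = (τ , tt , follows-self (post-ends post)) , post-finite someB post

proposition5p3 : (B : ℕ → Set) (B? : Decidable B) → ¬ (∀ n → ¬ B n) → (x : Var) →
    ⊢⟦ trueˢ ⟧ (x ≔ (λ σ → + 0)) ⨾ (whileˢ notᵉ (predᵉ B? x) doˢ (x ≔ (λ σ → σ x + + 1)))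
    ⟦ (trueᵗ ** ⟪ ⌜ predᵉ B? x ⌝ ⟫) ∧ᵗ (¬ᵗ infinite) ⟧
proposition5p3 B B? someB x = h-conseq (λ _ t → t) derivation (post-sound someB)
  where open LinearSearch B B? x
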